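{- Let $h=(h_1,\ldots,h_n)$ be a Hessenberg function. Then $I_h\subseteq I_h^{AD}$; in particular $I_h$ is generated by the $n$ polynomials $e_{h_i-(i-1)}(1,\ldots,h_i)$, $i=1,\ldots,n$.
   Context: A Hessenberg function is an $n$-tuple $h=(h_1,\ldots,h_n)$ of integers with $i\le h_i\le n$ for all $i$ and $h_i\le h_{i+1}$ for $1\le i\le n-1$. For $S\subseteq\{1,\ldots,n\}$, $e_d(S)$ is the sum of all squarefree monomials of degree $d$ in $x_i$, $i\in S$ (with $e_0(S)=1$, $e_d(S)=0$ for $d<0$ or $d>|S|$), and $e_d(1,\ldots,m)$ means $S=\{1,\ldots,m\}$. $I_h$ is the ideal of $\mathbb{Z}[x_1,\ldots,x_n]$ generated by $\{e_{h_i-r}(1,\ldots,h_i): 1\le i\le n,\ 0\le r\le i-1\}$, and $I_h^{AD}\subseteq I_h$ is the ideal generated by $e_{h_i-(i-1)}(1,\ldots,h_i)$ for $i=1,\ldots,n$. -}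

module Defs where

open import Data.Nat using (ℕ; zero; suc; _≤_; _∸_; _≟_)
open import Relation.Nullary using (yes; no)
open import Data.Integer as ℤ using (ℤ)
open import Data.Fin using (Fin; toℕ)
open import Data.List using (List; []; _∷_; length; take; allFin; _++_; map)
open import Data.Product using (Σ; _×_; ∃; ∃-syntax)
open import Relation.Binary.PropositionalEquality using (_≡_)

-- The polynomial ring ℤ[x₁,…,xₙ], constructed as the free commutative
-- ring over ℤ on the variables Fin n: syntax modulo the least
-- congruence containing the commutative-ring axioms and making the
-- constants a ring homomorphism from ℤ.  Variable (var j) is x_{j+1}.

infixl 6 _:+_
infixl 7 _:*_
infix 4 _≈_

data Poly (n : ℕ) : Set where
  con  : ℤ → Poly n
  var  : Fin n → Poly n
  _:+_ : Poly n → Poly n → Poly n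
  _:*_ : Poly n → Poly n → Poly n
  :-_  : Poly n → Poly n

data _≈_ {n : ℕ} : Poly n → Poly n → Set where
  refl  : ∀ {p} → p ≈ p
  sym   : ∀ {p q} → p ≈ q → q ≈ p
  trans : ∀ {p q r} → p ≈ q → q ≈ r → p ≈ r
  +-cong : ∀ {p p' q q'} → p ≈ p' → q ≈ q' → p :+ q ≈ p' :+ q'
  *-cong : ∀ {p p' q q'} → p ≈ p' → q ≈ q' → p :* q ≈ p' :* q'
  neg-cong : ∀ {p q} → p ≈ q → :- p ≈ :- q
  +-assoc : ∀ p q r → (p :+ q) :+ r ≈ p :+ (q :+ r)
  +-comm  : ∀ p q → p :+ q ≈ q :+ p
  +-identityˡ : ∀ p → con (ℤ.+ 0) :+ p ≈ p
  -‿inverseˡ : ∀ p → (:- p) :+ p ≈ con (ℤ.+ 0)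
  *-assoc : ∀ p q r → (p :* q) :* r ≈ p :* (q :* r)
  *-comm  : ∀ p q → p :* q ≈ q :* p
  *-identityˡ : ∀ p → con (ℤ.+ 1) :* p ≈ p
  distribʳ : ∀ p q r → (q :+ r) :* p ≈ (q :* p) :+ (r :* p)
  con-+ : ∀ a b → con (a ℤ.+ b) ≈ con a :+ con b
  con-* : ∀ a b → con (a ℤ.* b) ≈ con a :* con b
  con-- : ∀ a → con (ℤ.- a) ≈ :- con a

data InIdeal {n : ℕ} (G : Poly n → Set) : Poly n → Set where
  gen  : ∀ {p} → G p → InIdeal G p
  zero : InIdeal G (con (ℤ.+ 0))
  add  : ∀ {p q} → InIdeal G p → InIdeal G q → InIdeal G (p :+ q)
  mul  : ∀ {p} (a : Poly n) → InIdeal G p → InIdeal G (a :* p)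
  resp : ∀ {p q} → p ≈ q → InIdeal G p → InIdeal G q

-- Elementary symmetric polynomials e_d(S): the sum of all squarefree
-- monomials of degree d in the variables of S (S a duplicate-free list
-- of variables), i.e. the sum over all d-element sub-lists of S of the
-- product of their variables.

sublists : ∀ {A : Set} → List A → List (List A)
sublists [] = [] ∷ []
sublists (x ∷ xs) = sublists xs ++ map (x ∷_) (sublists xs)

monomial : ∀ {n} → List (Fin n) → Poly n
monomial [] = con (ℤ.+ 1)
monomial (j ∷ js) = var j :* monomial js

sumDeg : ∀ {n} → ℕ → List (List (Fin n)) → Poly n
sumDeg d [] = con (ℤ.+ 0)
sumDeg d (T ∷ Ts) with length T ≟ d
... | yes _ = monomial T :+ sumDeg d Ts
... | no  _ = sumDeg d Ts

e : ∀ {n} → ℕ → List (Fin n) → Poly n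
e d S = sumDeg d (sublists S)

upto : (n m : ℕ) → List (Fin n)
upto n m = take m (allFin n)

e[1‥_] : ∀ {n} → ℕ → ℕ → Poly n
e[1‥_] {n} m d = e d (upto n m)

-- Hessenberg functions, indexed 0-based: h i stands for h_{i+1}.
-- Conditions: i+1 ≤ h_{i+1} ≤ n and h weakly increasing.

record IsHessenberg (n : ℕ) (h : Fin n → ℕ) : Set where
  field
    lower : ∀ i → suc (toℕ i) ≤ h i
    upper : ∀ i → h i ≤ n
    mono  : ∀ i j → toℕ i ≤ toℕ j → h i ≤ h j

-- generators of I_h : e_{h_i - r}(1,…,h_i) for 0 ≤ r ≤ i-1
-- (with i = toℕ i' + 1, so r ≤ toℕ i').  Since r ≤ i-1 < h_i the
-- degree h_i - r is positive, so truncated subtraction is exact.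
GenIh : ∀ {n} → (Fin n → ℕ) → Poly n → Set
GenIh {n} h p = ∃[ i ] ∃[ r ] (r ≤ toℕ i × p ≡ e[1‥ h i ] (h i ∸ r))

GenIAD : ∀ {n} → (Fin n → ℕ) → Poly n → Set
GenIAD {n} h p = ∃[ i ] (p ≡ e[1‥ h i ] (h i ∸ toℕ i))

Ih : ∀ {n} → (Fin n → ℕ) → Poly n → Set
Ih h = InIdeal (GenIh h)

IhAD : ∀ {n} → (Fin n → ℕ) → Poly n → Set
IhAD h = InIdeal (GenIAD h)

-- Write J = I_h^{AD}. By e_{d+1}(S ∪ {y}) = e_{d+1}(S) + y e_d(S), if J contains every e_d(S)
-- with d ≥ t then it contains every e_d(S ∪ {y}) with d ≥ t + 1. By induction on i, J contains
-- every e_d(1,…,h_i) with d ≥ h_i - (i-1): for i = 1 these vanish for d > h_1, and passing from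
-- h_{i-1} to h_i adjoins h_i - h_{i-1} variables, which yields all d ≥ h_i - (i-2); the generator
-- e_{h_i-(i-1)}(1,…,h_i) of J supplies the remaining degree. The generators of I_h are among these.
module Submission where

open import Defs
open import Data.Nat using (ℕ; zero; suc; _+_; _∸_; _≤_; _<_; _≟_; s≤s)
open import Data.Nat.Properties as ℕ using ()
open import Data.Fin using (Fin; zero; suc; toℕ; inject₁)
open import Data.Fin.Properties using (toℕ-inject₁)
open import Data.Fin.Induction using (<-weakInduction)
open import Data.List using (List; []; _∷_; _∷ʳ_; length; take; drop; _++_; map)
open import Data.List.Properties using (length-take; take-[]; ++-assoc; ++-identityʳ)
open import Data.Product using (_×_; _,_)
open import Data.Integer as ℤ using ()
open import Data.Empty using (⊥-elim)
open import Level using (0ℓ)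
open import Algebra.Bundles using (CommutativeRing)
open import Algebra.Structures using (IsCommutativeRing)
import Algebra.Consequences.Setoid as Consequences
import Algebra.Properties.CommutativeSemigroup as CommSemigroupProperties
open import Relation.Binary.Bundles using (Setoid)
open import Relation.Binary.Structures using (IsEquivalence)
open import Relation.Nullary using (yes; no)
open import Relation.Binary.PropositionalEquality as Eq using (_≡_; cong; subst)

module _ (n : ℕ) where

  ≈-isEquivalence : IsEquivalence (_≈_ {n})
  ≈-isEquivalence = record { refl = refl ; sym = sym ; trans = trans }

  ≈-setoid : Setoid 0ℓ 0ℓ
  ≈-setoid = record { isEquivalence = ≈-isEquivalence }

  open Consequences ≈-setoid

  Poly-isCommutativeRing :
    IsCommutativeRing _≈_ _:+_ _:*_ :-_ (con (ℤ.+ 0)) (con (ℤ.+ 1))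
  Poly-isCommutativeRing = record
    { isRing = record
      { +-isAbelianGroup = record
        { isGroup = record
          { isMonoid = record
            { isSemigroup = record
              { isMagma = record { isEquivalence = ≈-isEquivalence ; ∙-cong = +-cong }
              ; assoc = +-assoc
              }
            ; identity = comm∧idˡ⇒id +-comm +-identityˡ
            }
          ; inverse = comm∧invˡ⇒inv +-comm -‿inverseˡ
          ; ⁻¹-cong = neg-cong
          }
        ; comm = +-comm
        }
      ; *-cong = *-cong
      ; *-assoc = *-assoc
      ; *-identity = comm∧idˡ⇒id *-comm *-identityˡ
      ; distrib = comm∧distrʳ⇒distr +-cong *-comm distribʳ
      }
    ; *-comm = *-comm
    }

Poly-commutativeRing : ℕ → CommutativeRing 0ℓ 0ℓ
Poly-commutativeRing n = record { isCommutativeRing = Poly-isCommutativeRing n }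

InIdeal-least : ∀ {n} {G G′ : Poly n → Set} →
  (∀ p → G p → InIdeal G′ p) → ∀ p → InIdeal G p → InIdeal G′ p
InIdeal-least G⊆ p (gen g)    = G⊆ p g
InIdeal-least G⊆ _ zero       = zero
InIdeal-least G⊆ _ (add p q)  = add (InIdeal-least G⊆ _ p) (InIdeal-least G⊆ _ q)
InIdeal-least G⊆ _ (mul a p)  = mul a (InIdeal-least G⊆ _ p)
InIdeal-least G⊆ _ (resp e p) = resp e (InIdeal-least G⊆ _ p)

take-+ : ∀ {A : Set} a s (xs : List A) → take (a + s) xs ≡ take a xs ++ take s (drop a xs)
take-+ zero    s xs       = Eq.refl
take-+ (suc a) s []       = Eq.sym (take-[] s)
take-+ (suc a) s (x ∷ xs) = cong (x ∷_) (take-+ a s xs)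

length-take≤ : ∀ {A : Set} m (xs : List A) → length (take m xs) ≤ m
length-take≤ m xs = subst (_≤ m) (Eq.sym (length-take m xs)) (ℕ.m⊓n≤m m (length xs))

module _ {n : ℕ} where

  open CommutativeRing (Poly-commutativeRing n)
    using (setoid; +-identityʳ; distribˡ; zeroʳ; +-commutativeSemigroup; *-commutativeSemigroup)
  open CommSemigroupProperties +-commutativeSemigroup using (interchange; xy∙z≈xz∙y)
  open CommSemigroupProperties *-commutativeSemigroup using (x∙yz≈y∙xz)
  open import Relation.Binary.Reasoning.Setoid setoid

  private
    0P 1P : Poly n
    0P = con (ℤ.+ 0)
    1P = con (ℤ.+ 1)

  esym : ℕ → List (Fin n) → Poly n
  esym zero    _        = 1P
  esym (suc d) []       = 0P
  esym (suc d) (x ∷ xs) = esym (suc d) xs :+ var x :* esym d xs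

  sumDeg-++ : ∀ d (Ts Us : List (List (Fin n))) →
    sumDeg d (Ts ++ Us) ≈ sumDeg d Ts :+ sumDeg d Us
  sumDeg-++ d []       Us = sym (+-identityˡ _)
  sumDeg-++ d (T ∷ Ts) Us with length T ≟ d
  ... | yes _ = trans (+-cong refl (sumDeg-++ d Ts Us)) (sym (+-assoc _ _ _))
  ... | no  _ = sumDeg-++ d Ts Us

  sumDeg-zero-map-∷ : ∀ x (Ts : List (List (Fin n))) → sumDeg 0 (map (x ∷_) Ts) ≡ 0P
  sumDeg-zero-map-∷ x []       = Eq.refl
  sumDeg-zero-map-∷ x (T ∷ Ts) = sumDeg-zero-map-∷ x Ts

  sumDeg-suc-map-∷ : ∀ x d (Ts : List (List (Fin n))) →
    sumDeg (suc d) (map (x ∷_) Ts) ≈ var x :* sumDeg d Ts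
  sumDeg-suc-map-∷ x d [] = sym (zeroʳ _)
  sumDeg-suc-map-∷ x d (T ∷ Ts) with length T ≟ d | suc (length T) ≟ suc d
  ... | yes _   | yes _   = trans (+-cong refl (sumDeg-suc-map-∷ x d Ts)) (sym (distribˡ _ _ _))
  ... | yes T≡d | no  T≢d = ⊥-elim (T≢d (cong suc T≡d))
  ... | no  T≢d | yes T≡d = ⊥-elim (T≢d (ℕ.suc-injective T≡d))
  ... | no  _   | no  _   = sumDeg-suc-map-∷ x d Ts

  e≈esym : ∀ d (xs : List (Fin n)) → e d xs ≈ esym d xs
  e≈esym zero    []       = +-identityʳ _
  e≈esym (suc d) []       = refl
  e≈esym zero    (x ∷ xs) = begin
    sumDeg 0 (sublists xs ++ map (x ∷_) (sublists xs))     ≈⟨ sumDeg-++ 0 (sublists xs) _ ⟩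
    e 0 xs :+ sumDeg 0 (map (x ∷_) (sublists xs))          ≡⟨ cong (e 0 xs :+_) (sumDeg-zero-map-∷ x (sublists xs)) ⟩
    e 0 xs :+ 0P                                           ≈⟨ +-identityʳ _ ⟩
    e 0 xs                                                 ≈⟨ e≈esym 0 xs ⟩
    1P                                                     ∎
  e≈esym (suc d) (x ∷ xs) = begin
    sumDeg (suc d) (sublists xs ++ map (x ∷_) (sublists xs)) ≈⟨ sumDeg-++ (suc d) (sublists xs) _ ⟩
    e (suc d) xs :+ sumDeg (suc d) (map (x ∷_) (sublists xs)) ≈⟨ +-cong (e≈esym (suc d) xs) (sumDeg-suc-map-∷ x d (sublists xs)) ⟩
    esym (suc d) xs :+ var x :* e d xs                        ≈⟨ +-cong refl (*-cong refl (e≈esym d xs)) ⟩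
    esym (suc d) xs :+ var x :* esym d xs                     ∎

  esym-∷ʳ : ∀ d (xs : List (Fin n)) y →
    esym (suc d) (xs ∷ʳ y) ≈ esym (suc d) xs :+ var y :* esym d xs
  esym-∷ʳ d       []       y = refl
  esym-∷ʳ zero    (x ∷ xs) y = begin
    esym 1 (xs ∷ʳ y) :+ var x :* 1P            ≈⟨ +-cong (esym-∷ʳ zero xs y) refl ⟩
    (esym 1 xs :+ var y :* 1P) :+ var x :* 1P  ≈⟨ xy∙z≈xz∙y _ _ _ ⟩
    (esym 1 xs :+ var x :* 1P) :+ var y :* 1P  ∎
  esym-∷ʳ (suc d) (x ∷ xs) y = begin
    esym (2 + d) (xs ∷ʳ y) :+ var x :* esym (suc d) (xs ∷ʳ y)
      ≈⟨ +-cong (esym-∷ʳ (suc d) xs y) (*-cong refl (esym-∷ʳ d xs y)) ⟩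
    (A :+ var y :* B) :+ var x :* (B :+ var y :* C)
      ≈⟨ +-cong refl (distribˡ _ _ _) ⟩
    (A :+ var y :* B) :+ (var x :* B :+ var x :* (var y :* C))
      ≈⟨ interchange _ _ _ _ ⟩
    (A :+ var x :* B) :+ (var y :* B :+ var x :* (var y :* C))
      ≈⟨ +-cong refl (+-cong refl (x∙yz≈y∙xz _ _ _)) ⟩
    (A :+ var x :* B) :+ (var y :* B :+ var y :* (var x :* C))
      ≈⟨ +-cong refl (sym (distribˡ _ _ _)) ⟩
    (A :+ var x :* B) :+ var y :* (B :+ var x :* C)
      ∎
    where
    A = esym (2 + d) xs
    B = esym (suc d) xs
    C = esym d xs

  esym-vanishes : ∀ d (xs : List (Fin n)) → length xs < d → esym d xs ≈ 0P
  esym-vanishes (suc d) []       _          = refl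
  esym-vanishes (suc d) (x ∷ xs) (s≤s xs<d) = begin
    esym (suc d) xs :+ var x :* esym d xs ≈⟨ +-cong (esym-vanishes (suc d) xs (ℕ.m<n⇒m<1+n xs<d))
                                                    (*-cong refl (esym-vanishes d xs xs<d)) ⟩
    0P :+ var x :* 0P                     ≈⟨ +-identityˡ _ ⟩
    var x :* 0P                           ≈⟨ zeroʳ _ ⟩
    0P                                    ∎

  EsymInIdealFrom : (Poly n → Set) → ℕ → List (Fin n) → Set
  EsymInIdealFrom G t xs = ∀ d → t ≤ d → InIdeal G (esym d xs)

  module _ {G : Poly n → Set} where

    EsymInIdealFrom-mono : ∀ {t u xs} → t ≤ u → EsymInIdealFrom G t xs → EsymInIdealFrom G u xs
    EsymInIdealFrom-mono t≤u from d u≤d = from d (ℕ.≤-trans t≤u u≤d)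

    EsymInIdealFrom-length : ∀ xs → EsymInIdealFrom G (suc (length xs)) xs
    EsymInIdealFrom-length xs d xs<d = resp (sym (esym-vanishes d xs xs<d)) zero

    EsymInIdealFrom-extend : ∀ {t xs} → InIdeal G (esym t xs) →
      EsymInIdealFrom G (suc t) xs → EsymInIdealFrom G t xs
    EsymInIdealFrom-extend {t} et from d t≤d with t ≟ d
    ... | yes Eq.refl = et
    ... | no  t≢d     = from d (ℕ.≤∧≢⇒< t≤d t≢d)

    EsymInIdealFrom-∷ʳ : ∀ {t xs} y → EsymInIdealFrom G t xs → EsymInIdealFrom G (suc t) (xs ∷ʳ y)
    EsymInIdealFrom-∷ʳ {xs = xs} y from (suc d) (s≤s t≤d) =
      resp (sym (esym-∷ʳ d xs y)) (add (from (suc d) (ℕ.m≤n⇒m≤1+n t≤d)) (mul (var y) (from d t≤d)))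

    EsymInIdealFrom-++ : ∀ {t} xs ys → EsymInIdealFrom G t xs → EsymInIdealFrom G (t + length ys) (xs ++ ys)
    EsymInIdealFrom-++ {t} xs [] from
      rewrite ℕ.+-identityʳ t | ++-identityʳ xs = from
    EsymInIdealFrom-++ {t} xs (y ∷ ys) from
      rewrite ℕ.+-suc t (length ys) | Eq.sym (++-assoc xs (y ∷ []) ys) =
      EsymInIdealFrom-++ (xs ∷ʳ y) ys (EsymInIdealFrom-∷ʳ y from)

    EsymInIdealFrom-take : ∀ {t a b} (xs : List (Fin n)) → a ≤ b →
      EsymInIdealFrom G t (take a xs) → EsymInIdealFrom G (t + (b ∸ a)) (take b xs)
    EsymInIdealFrom-take {t} {a} {b} xs a≤b from = subst (EsymInIdealFrom G (t + (b ∸ a)))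
      (Eq.trans (Eq.sym (take-+ a (b ∸ a) xs)) (cong (λ m → take m xs) (ℕ.m+[n∸m]≡n a≤b)))
      (EsymInIdealFrom-mono (ℕ.+-monoʳ-≤ t (length-take≤ (b ∸ a) (drop a xs)))
        (EsymInIdealFrom-++ (take a xs) (take (b ∸ a) (drop a xs)) from))

[m∸k]+[n∸m]≡1+[n∸1+k] : ∀ {k m n} → k < m → m ≤ n → (m ∸ k) + (n ∸ m) ≡ suc (n ∸ suc k)
[m∸k]+[n∸m]≡1+[n∸1+k] {k} {m} {n} k<m m≤n = begin
  (m ∸ k) + (n ∸ m)   ≡⟨ ℕ.+-∸-comm (n ∸ m) (ℕ.<⇒≤ k<m) ⟨
  (m + (n ∸ m)) ∸ k   ≡⟨ cong (_∸ k) (ℕ.m+[n∸m]≡n m≤n) ⟩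
  n ∸ k               ≡⟨ ℕ.+-∸-assoc 1 (ℕ.≤-trans k<m m≤n) ⟩
  suc (n ∸ suc k)     ∎
  where open Eq.≡-Reasoning

generator∈IhAD : ∀ {n} (h : Fin n → ℕ) i → IhAD h (esym (h i ∸ toℕ i) (upto n (h i)))
generator∈IhAD h i = resp (e≈esym _ _) (gen (i , Eq.refl))

esym-upto-h-∈IhAD : ∀ {n} (h : Fin n → ℕ) → IsHessenberg n h →
  ∀ i → EsymInIdealFrom (GenIAD h) (h i ∸ toℕ i) (upto n (h i))
esym-upto-h-∈IhAD {zero}  h hess ()
esym-upto-h-∈IhAD {suc n} h hess = <-weakInduction P base step
  where
  open IsHessenberg hess
  P : Fin (suc n) → Set
  P i = EsymInIdealFrom (GenIAD h) (h i ∸ toℕ i) (upto (suc n) (h i))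

  base : P zero
  base = EsymInIdealFrom-extend (generator∈IhAD h zero)
    (EsymInIdealFrom-mono (s≤s (length-take≤ (h zero) _)) (EsymInIdealFrom-length _))

  step : ∀ i → P (inject₁ i) → P (suc i)
  step i P[i] = EsymInIdealFrom-extend (generator∈IhAD h (suc i))
    (subst (λ t → EsymInIdealFrom (GenIAD h) t (upto (suc n) b))
      ([m∸k]+[n∸m]≡1+[n∸1+k] k<a a≤b)
      (EsymInIdealFrom-take _ a≤b P[i]′))
    where
    k = toℕ i
    a = h (inject₁ i)
    b = h (suc i)
    P[i]′ : EsymInIdealFrom (GenIAD h) (a ∸ k) (upto (suc n) a)
    P[i]′ = subst (λ j → EsymInIdealFrom (GenIAD h) (a ∸ j) (upto (suc n) a)) (toℕ-inject₁ i) P[i]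
    k<a : k < a
    k<a = subst (λ j → suc j ≤ a) (toℕ-inject₁ i) (lower (inject₁ i))
    a≤b : a ≤ b
    a≤b = mono (inject₁ i) (suc i) (ℕ.≤-trans (ℕ.≤-reflexive (toℕ-inject₁ i)) (ℕ.n≤1+n k))

theorem4p16 : (n : ℕ) (h : Fin n → ℕ) → IsHessenberg n h →
    (∀ p → Ih h p → IhAD h p) × (∀ p → IhAD h p → Ih h p)
theorem4p16 n h hess = InIdeal-least Ih-generator∈IhAD , InIdeal-least IhAD-generator∈Ih
  where
  Ih-generator∈IhAD : ∀ p → GenIh h p → IhAD h p
  Ih-generator∈IhAD _ (i , r , r≤i , Eq.refl) = resp (sym (e≈esym _ _))
    (esym-upto-h-∈IhAD h hess i (h i ∸ r) (ℕ.∸-monoʳ-≤ (h i) r≤i))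
  IhAD-generator∈Ih : ∀ p → GenIAD h p → Ih h p
  IhAD-generator∈Ih _ (i , eq) = gen (i , toℕ i , ℕ.≤-refl , eq)
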